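{- Let $k\ge 1$ and $s_1,\dots,s_k\in\mathbb{N}$ with $s_i\ge 3$ for all $i$. Then $$m(s_1,\dots,s_k)\le \prod_{j=0}^{\max_i s_i-3}\left\lceil \frac{\frac{R(s_1,\dots,s_k)-2}{k}-j}{\min_t s_t-2}\right\rceil.$$
   Context: $K_n$ denotes the complete graph on $n$ vertices. For $s_1,\dots,s_k\in\mathbb{N}$, the Ramsey number $R(s_1,\dots,s_k)$ is the smallest $n$ such that every coloring of the edges of $K_n$ with colors $\{1,\dots,k\}$ contains, for some $i$, a subgraph isomorphic to $K_{s_i}$ all of whose edges have color $i$ (a "monochromatic $K_{s_i}$ in color $i$"). The critical multiplicity $m(s_1,\dots,s_k)$ is the largest number $M$ such that every coloring of the edges of $K_{R(s_1,\dots,s_k)}$ with colors $\{1,\dots,k\}$ contains at least $M$ subgraphs each of which, for some $i\in\{1,\dots,k\}$, is isomorphic to $K_{s_i}$ and monochromatic in color $i$. -}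

module Defs where

open import Data.Bool using (Bool; true; false; _∧_; if_then_else_)
open import Data.Nat as ℕ using (ℕ; zero; suc; _∸_; _<_; _≤_; _⊔_; _⊓_; _<ᵇ_; _≡ᵇ_; NonZero)
open import Data.Fin as Fin using (Fin; toℕ)
open import Data.Fin.Properties using (_≟_)
open import Data.Vec as Vec using (Vec; []; _∷_; lookup)
open import Data.List as List using (List; []; _∷_; allFin; map; foldr; concatMap; length; filterᵇ; upTo)
open import Data.Bool.ListAction using (all; any)
open import Data.Integer as ℤ using (ℤ; +_)
open import Data.Rational as ℚ using (ℚ)
open import Data.Product using (Σ; _×_)
open import Relation.Nullary using (¬_; does)
open import Relation.Binary.PropositionalEquality using (_≡_)

-- An edge colouring of K_n with k colours.  The colour of the edge {x,y}
-- (x < y) is c x y; values with x ≥ y are ignored everywhere.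
Coloring : ℕ → ℕ → Set
Coloring n k = Fin n → Fin n → Fin k

VSubset : ℕ → Set
VSubset n = Vec Bool n

allSubsets : (n : ℕ) → List (VSubset n)
allSubsets zero = [] ∷ []
allSubsets (suc n) = concatMap (λ v → (false ∷ v) ∷ (true ∷ v) ∷ []) (allSubsets n)

size : ∀ {n} → VSubset n → ℕ
size [] = 0
size (true ∷ v) = suc (size v)
size (false ∷ v) = size v

monoIn : ∀ {n k} → Coloring n k → VSubset n → Fin k → Bool
monoIn {n} c S a =
  all (λ x → all (λ y →
        if lookup S x ∧ lookup S y ∧ (toℕ x <ᵇ toℕ y)
        then does (c x y ≟ a) else true) (allFin n)) (allFin n)

isMonoClique : ∀ {n k} → (Fin k → ℕ) → Coloring n k → VSubset n → Bool
isMonoClique {n} {k} s c S =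
  any (λ i → (size S ≡ᵇ s i) ∧ monoIn c S i) (allFin k)

countMono : ∀ {n k} → (Fin k → ℕ) → Coloring n k → ℕ
countMono {n} s c = length (filterᵇ (isMonoClique s c) (allSubsets n))

Arrows : (n k : ℕ) → (Fin k → ℕ) → Set
Arrows n k s = (c : Coloring n k) → Σ (VSubset n) (λ S → isMonoClique s c S ≡ true)

IsRamsey : (k : ℕ) → (Fin k → ℕ) → ℕ → Set
IsRamsey k s n = Arrows n k s × ((n' : ℕ) → n' < n → ¬ Arrows n' k s)

IsCritMult : (k : ℕ) → (Fin k → ℕ) → (R M : ℕ) → Set
IsCritMult k s R M =
  ((c : Coloring R k) → M ≤ countMono s c) ×
  ((M' : ℕ) → ((c : Coloring R k) → M' ≤ countMono s c) → M' ≤ M)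

maxS : (k : ℕ) → (Fin k → ℕ) → ℕ
maxS k s = foldr _⊔_ 0 (map s (allFin k))

minS : (k : ℕ) → (Fin k → ℕ) → ℕ
minS zero s = 0
minS (suc k) s = foldr _⊓_ (s Fin.zero) (map s (allFin (suc k)))

-- p / d in ℚ for a natural d (junk value 0 when d = 0; never used here)
divℕ : ℚ → ℕ → ℚ
divℕ p zero = ℚ.0ℚ
divℕ p (suc d) = p ℚ.* (+ 1 ℚ./ suc d)

bound : (k : ℕ) → .{{NonZero k}} → (Fin k → ℕ) → ℕ → ℤ
bound k s R =
  foldr ℤ._*_ (+ 1)
    (map (λ j → ℚ.⌈ divℕ (((+ R ℤ.- + 2) ℚ./ k) ℚ.- (+ j ℚ./ 1)) (minS k s ∸ 2) ⌉)
         (upTo (maxS k s ∸ 2)))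

-- By minimality of R there is a colouring c of K_{R-1} without monochromatic
-- K_{s_i} in colour i, and by pigeonhole some colour i occurs on at most (R-2)/k of the edges
-- at vertex 0.  Duplicating vertex 0 and giving the edge between the two copies colour i
-- yields a colouring of K_R in which every monochromatic clique contains both copies; the
-- rest of such a clique is a colour-i K_{s_i-2} inside the colour-i neighbourhood N of
-- vertex 0, and N contains no colour-i K_{s_i-1}.  Zykov's symmetrisation bounds the number
-- of K_t's in a K_{t+1}-free graph on a vertices by the number of K_t's of the Turán graph
-- T(a, t), which is ∏_{j<t} ⌈(a-j)/t⌉.  As min s - 2 ≤ t = s_i - 2 ≤ max s - 2, this is at
-- most the stated product; its remaining factors are at least 1 because a block colouring
-- shows R - 2 > k (max s - 3).

module Submission where

open import Defs
open import Data.Nat using (ℕ; _≤_; NonZero)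
open import Data.Fin using (Fin)
open import Data.Integer as ℤ using (+_)

open import Data.Bool.Base using (Bool; true; false; T; if_then_else_)
open import Data.Bool.ListAction using (all; any)
open import Data.Bool.Properties using (T-≡; T-∧)
open import Data.Empty using (⊥-elim)
open import Data.Fin.Base as Fin using (Fin; zero; suc; toℕ; fromℕ<; punchIn)
open import Data.Fin.Properties using (_≟_; ¬Fin0; toℕ<n; toℕ-fromℕ<; punchIn-injective; punchInᵢ≢i)
import Data.Fin.Properties as Fin
open import Data.Fin.Subset using (Subset; inside; outside; _∈_; _∉_; _⊆_; ∣_∣; _∩_; ∁)
open import Data.Fin.Subset.Properties
  using (_∈?_; _⊆?_; drop-there; x∈p∩q⁺; x∈p∩q⁻; x∉p⇒x∈∁p; anySubset?; nonempty?)
open import Data.Integer.Base using (ℤ)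
import Data.Integer.DivMod as ℤ
import Data.Integer.Properties as ℤ
import Data.Integer.Tactic.RingSolver as ℤ
open import Data.List.Base using (List; []; _∷_; length; filter; concatMap; allFin; foldr; map; applyUpTo)
open import Data.List.Extrema.Nat using (argmax; argmin; f[xs]≤f[argmax]; f[argmin]≤f[xs])
open import Data.List.Membership.Propositional.Properties using (∈-allFin)
open import Data.List.Properties using (length-filter; map-applyUpTo; foldr-preservesᵇ; foldr-forcesᵇ)
open import Data.List.Relation.Binary.Sublist.Heterogeneous.Properties using (length-mono-≤)
open import Data.List.Relation.Binary.Sublist.Propositional using (⊆-refl)
open import Data.List.Relation.Binary.Sublist.Propositional.Properties using (filter⁺)
import Data.List.Relation.Unary.All as All
import Data.List.Relation.Unary.All.Properties as All
import Data.List.Relation.Unary.Any as Any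
import Data.List.Relation.Unary.Any.Properties as Any
open import Data.Nat.Base as ℕ using (zero; suc; _+_; _*_; _∸_; _<_; _⊔_; _⊓_; z≤n; s≤s; z<s; s<s; s≤s⁻¹)
open import Data.Nat.DivMod using (_/_; _%_; m≡m%n+[m/n]*n; m%n<n; m/n*n≤m; m*n/n≡m; /-monoˡ-≤; n/1≡n; m<n*o⇒m/o<n)
open import Data.Nat.Properties hiding (_≟_)
import Data.Nat.Properties as ℕ
open import Data.Nat.Tactic.RingSolver using (solve-∀)
open import Data.Product.Base using (∃; ∃-syntax; ∃₂; _×_; _,_; proj₁; proj₂; map₁)
import Data.Product.Base as Product
open import Data.Rational.Base as ℚ using (ℚ; ↥_; ↧_)
import Data.Rational.Properties as ℚ
open import Data.Rational.Unnormalised.Base as ℚᵘ using (ℚᵘ; mkℚᵘ; *<*)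
import Data.Rational.Unnormalised.Properties as ℚᵘ
open import Data.Sum.Base using (_⊎_; inj₁; inj₂; [_,_]′)
import Data.Sum.Base as Sum
open import Data.Unit.Base using (tt)
open import Data.Vec.Base using ([]; _∷_; here; there; _[_]≔_; tabulate; lookup)
open import Data.Vec.Properties using ([]=⇒lookup; lookup⇒[]=; lookup∘tabulate; tabulate-cong)
open import Function.Base using (_∘_; id)
open import Function.Bundles using (_⇔_; Equivalence; mk⇔)
open import Level using (Level)
open import Relation.Binary.Definitions using (tri<; tri≈; tri>)
open import Relation.Binary.PropositionalEquality
  using (_≡_; _≢_; refl; sym; trans; cong; cong₂; subst; subst₂; module ≡-Reasoning)
open import Relation.Nullary using (¬_; Dec; yes; no; does; _because_; _×-dec_; _⊎-dec_; ¬?)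
open import Relation.Nullary.Decidable using (T?; dec-true; does-⇔; decidable-stable)
import Relation.Nullary.Decidable as Dec
open import Relation.Nullary.Reflects using (invert)
open import Relation.Unary using (Pred; Decidable)

open import Algebra.Properties.CommutativeSemigroup +-commutativeSemigroup using (interchange)
open import Algebra.Properties.CommutativeMonoid.Sum +-0-commutativeMonoid
  using (sum-syntax; ∑-distrib-+; sum-cong-≗; sum-replicate-zero)

open Equivalence using (to; from)

private
  variable
    ℓ : Level
    n : ℕ

∣∣-insert : ∀ (S : Subset n) x → x ∉ S → ∣ S [ x ]≔ inside ∣ ≡ suc ∣ S ∣
∣∣-insert (outside ∷ S) zero    x∉S = refl
∣∣-insert (inside ∷ S)  zero    x∉S = ⊥-elim (x∉S here)
∣∣-insert (outside ∷ S) (suc x) x∉S = ∣∣-insert S x (x∉S ∘ there)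
∣∣-insert (inside ∷ S)  (suc x) x∉S = cong suc (∣∣-insert S x (x∉S ∘ there))

∈-insert⁺ : ∀ (S : Subset n) x {y} → y ∈ S → y ∈ S [ x ]≔ inside
∈-insert⁺ (b ∷ S) zero    here      = here
∈-insert⁺ (b ∷ S) zero    (there p) = there p
∈-insert⁺ (b ∷ S) (suc x) here      = here
∈-insert⁺ (b ∷ S) (suc x) (there p) = there (∈-insert⁺ S x p)

x∈insert : ∀ (S : Subset n) x → x ∈ S [ x ]≔ inside
x∈insert (b ∷ S) zero    = here
x∈insert (b ∷ S) (suc x) = there (x∈insert S x)

∈-insert⁻ : ∀ (S : Subset n) x {y} → y ∈ S [ x ]≔ inside → y ≡ x ⊎ y ∈ S
∈-insert⁻ (b ∷ S) zero    here      = inj₁ refl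
∈-insert⁻ (b ∷ S) zero    (there p) = inj₂ (there p)
∈-insert⁻ (b ∷ S) (suc x) here      = inj₂ here
∈-insert⁻ (b ∷ S) (suc x) (there p) = Sum.map (cong suc) there (∈-insert⁻ S x p)

∣p∩q∣+∣p∩∁q∣≡∣p∣ : ∀ (p q : Subset n) → ∣ p ∩ q ∣ + ∣ p ∩ ∁ q ∣ ≡ ∣ p ∣
∣p∩q∣+∣p∩∁q∣≡∣p∣ []            []            = refl
∣p∩q∣+∣p∩∁q∣≡∣p∣ (outside ∷ p) (_ ∷ q)       = ∣p∩q∣+∣p∩∁q∣≡∣p∣ p q
∣p∩q∣+∣p∩∁q∣≡∣p∣ (inside ∷ p)  (inside ∷ q)  = cong suc (∣p∩q∣+∣p∩∁q∣≡∣p∣ p q)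
∣p∩q∣+∣p∩∁q∣≡∣p∣ (inside ∷ p)  (outside ∷ q) = trans (+-suc _ _) (cong suc (∣p∩q∣+∣p∩∁q∣≡∣p∣ p q))

∣∣>0⇒nonempty : ∀ (S : Subset n) → 0 < ∣ S ∣ → ∃[ x ] x ∈ S
∣∣>0⇒nonempty (inside ∷ S)  _     = zero , here
∣∣>0⇒nonempty (outside ∷ S) 0<∣S∣ = Product.map suc there (∣∣>0⇒nonempty S 0<∣S∣)

∣∣≤-strictlyIncreasing : ∀ (S : Subset n) (f : Fin n → ℕ) {lo hi} →
                         (∀ {x} → x ∈ S → lo ≤ f x × f x < hi) →
                         (∀ {x y} → x ∈ S → y ∈ S → x Fin.< y → f x < f y) → ∣ S ∣ ≤ hi ∸ lo
∣∣≤-strictlyIncreasing []            f bounded increasing = z≤n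
∣∣≤-strictlyIncreasing (outside ∷ S) f bounded increasing =
  ∣∣≤-strictlyIncreasing S (f ∘ suc) (bounded ∘ there) (λ x∈ y∈ x<y → increasing (there x∈) (there y∈) (s<s x<y))
∣∣≤-strictlyIncreasing (inside ∷ S)  f {lo} {hi} bounded increasing = begin
  suc ∣ S ∣               ≤⟨ s≤s (∣∣≤-strictlyIncreasing S (f ∘ suc) bounded′ increasing′) ⟩
  suc (hi ∸ suc (f zero)) ≡⟨ +-∸-assoc 1 (proj₂ (bounded here)) ⟨
  hi ∸ f zero             ≤⟨ ∸-monoʳ-≤ hi (proj₁ (bounded here)) ⟩
  hi ∸ lo                 ∎
  where
  open ≤-Reasoning
  bounded′ : ∀ {x} → x ∈ S → suc (f zero) ≤ f (suc x) × f (suc x) < hi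
  bounded′ x∈ = increasing here (there x∈) z<s , proj₂ (bounded (there x∈))
  increasing′ : ∀ {x y} → x ∈ S → y ∈ S → x Fin.< y → f (suc x) < f (suc y)
  increasing′ x∈ y∈ x<y = increasing (there x∈) (there y∈) (s<s x<y)

two∈ : ∀ (S : Subset n) → 2 ≤ ∣ S ∣ → ∃₂ λ x y → x ∈ S × y ∈ S × x Fin.< y
two∈ (inside ∷ S)  (s≤s 0<∣S∣) = let y , y∈S = ∣∣>0⇒nonempty S 0<∣S∣ in zero , suc y , here , there y∈S , z<s
two∈ (outside ∷ S) 2≤∣S∣ =
  let x , y , x∈S , y∈S , x<y = two∈ S 2≤∣S∣ in suc x , suc y , there x∈S , there y∈S , s<s x<y

three∈ : ∀ (S : Subset n) → 3 ≤ ∣ S ∣ → ∃ λ x → ∃₂ λ y z → x ∈ S × y ∈ S × z ∈ S × x Fin.< y × y Fin.< z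
three∈ (inside ∷ S)  (s≤s 2≤∣S∣) =
  let y , z , y∈S , z∈S , y<z = two∈ S 2≤∣S∣ in zero , suc y , suc z , here , there y∈S , there z∈S , z<s , s<s y<z
three∈ (outside ∷ S) 3≤∣S∣ =
  let x , y , z , x∈S , y∈S , z∈S , x<y , y<z = three∈ S 3≤∣S∣ in
  suc x , suc y , suc z , there x∈S , there y∈S , there z∈S , s<s x<y , s<s y<z

T-does⇔ : ∀ {a} {A : Set a} (a? : Dec A) → T (does a?) ⇔ A
T-does⇔ (true  because [a])  = mk⇔ (λ _ → invert [a]) _
T-does⇔ (false because [¬a]) = mk⇔ (λ ()) (invert [¬a])

setOf : ∀ {ℓ} {P : Pred (Fin n) ℓ} → Decidable P → Subset n
setOf P? = tabulate (does ∘ P?)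

module _ {ℓ} {P : Pred (Fin n) ℓ} (P? : Decidable P) where

  ∈-setOf⁺ : ∀ {x} → P x → x ∈ setOf P?
  ∈-setOf⁺ {x} px = lookup⇒[]= x _ (trans (lookup∘tabulate _ x) (dec-true (P? x) px))

  ∈-setOf⁻ : ∀ {x} → x ∈ setOf P? → P x
  ∈-setOf⁻ {x} x∈ = to (T-does⇔ (P? x)) (from T-≡ (trans (sym (lookup∘tabulate _ x)) ([]=⇒lookup x∈)))

∑-const : ∀ k x → ∑[ i < k ] x ≡ k * x
∑-const zero    x = refl
∑-const (suc k) x = cong (_+_ x) (∑-const k x)

∑-mono : ∀ {k} {f g : Fin k → ℕ} → (∀ i → f i ≤ g i) → ∑[ i < k ] f i ≤ ∑[ i < k ] g i
∑-mono {zero}  f≤g = z≤n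
∑-mono {suc k} f≤g = +-mono-≤ (f≤g zero) (∑-mono (f≤g ∘ suc))

∑-indicator : ∀ {k} (a : Fin k) → ∑[ i < k ] (if does (a ≟ i) then 1 else 0) ≡ 1
∑-indicator {suc k} zero    = cong suc (sum-replicate-zero k)
∑-indicator {suc k} (suc a) = ∑-indicator a

∣setOf∣-suc : ∀ {m} {P : Fin (suc m) → Set} (P? : ∀ x → Dec (P x)) →
              ∣ setOf P? ∣ ≡ (if does (P? zero) then 1 else 0) + ∣ setOf (P? ∘ suc) ∣
∣setOf∣-suc P? with does (P? zero)
... | true  = refl
... | false = refl

∑-∣fibre∣ : ∀ {m k} (f : Fin m → Fin k) → ∑[ i < k ] ∣ setOf (λ y → f y ≟ i) ∣ ≡ m
∑-∣fibre∣ {zero}  {k} f = sum-replicate-zero k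
∑-∣fibre∣ {suc m} {k} f = begin
  ∑[ i < k ] ∣ setOf (λ y → f y ≟ i) ∣  ≡⟨ sum-cong-≗ (λ i → ∣setOf∣-suc (λ y → f y ≟ i)) ⟩
  ∑[ i < k ] (δ i + rest i)              ≡⟨ ∑-distrib-+ δ rest ⟩
  ∑[ i < k ] δ i + ∑[ i < k ] rest i     ≡⟨ cong₂ _+_ (∑-indicator (f zero)) (∑-∣fibre∣ (f ∘ suc)) ⟩
  suc m                                  ∎
  where
  open ≡-Reasoning
  δ rest : Fin k → ℕ
  δ i    = if does (f zero ≟ i) then 1 else 0
  rest i = ∣ setOf (λ y → f (suc y) ≟ i) ∣

pigeonhole : ∀ {k′} (g : Fin (suc k′) → ℕ) → ∃[ i ] suc k′ * g i ≤ ∑[ j < suc k′ ] g j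
pigeonhole {k′} g = i , (begin
  suc k′ * g i            ≡⟨ ∑-const (suc k′) (g i) ⟨
  ∑[ j < suc k′ ] g i     ≤⟨ ∑-mono (λ j → All.lookup gᵢ≤ (∈-allFin j)) ⟩
  ∑[ j < suc k′ ] g j     ∎)
  where
  open ≤-Reasoning
  i = argmin g zero (allFin (suc k′))
  gᵢ≤ = f[argmin]≤f[xs] {f = g} zero (allFin (suc k′))

∑-supported-≤ : ∀ (B : Subset n) (f : Fin n → ℕ) {D} → (∀ {x} → x ∉ B → f x ≡ 0) → (∀ {x} → x ∈ B → f x ≤ D) →
              ∑[ x < n ] f x ≤ ∣ B ∣ * D
∑-supported-≤ []            f outside≡0 inside≤D = z≤n
∑-supported-≤ (inside ∷ B)  f outside≡0 inside≤D =
  +-mono-≤ (inside≤D here) (∑-supported-≤ B (f ∘ suc) (λ x∉B → outside≡0 (x∉B ∘ drop-there)) (inside≤D ∘ there))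
∑-supported-≤ (outside ∷ B) f outside≡0 inside≤D rewrite outside≡0 {zero} (λ ()) =
  ∑-supported-≤ B (f ∘ suc) (λ x∉B → outside≡0 (x∉B ∘ drop-there)) (inside≤D ∘ there)

-- Opaque so that `# P?` is rigid: unification then recovers the predicate from a count.
opaque
  # : {P : Pred (Subset n) ℓ} → Decidable P → ℕ
  # P? = length (filter P? (allSubsets _))

module _ {A : Set} {P Q : Pred A ℓ} (P? : Decidable P) (Q? : Decidable Q) where

  length-filter-mono : (∀ {x} → P x → Q x) → ∀ xs → length (filter P? xs) ≤ length (filter Q? xs)
  length-filter-mono P⇒Q xs = length-mono-≤ (filter⁺ P? Q? (λ { refl → P⇒Q }) (⊆-refl {x = xs}))

  length-filter-∪ : {R : Pred A ℓ} (R? : Decidable R) → (∀ {x} → P x → Q x ⊎ R x) → ∀ xs →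
                    length (filter P? xs) ≤ length (filter Q? xs) + length (filter R? xs)
  length-filter-∪ R? P⇒Q∪R [] = z≤n
  length-filter-∪ R? P⇒Q∪R (x ∷ xs) with ih ← length-filter-∪ R? P⇒Q∪R xs | P? x | Q? x | R? x
  ... | no _   | no _  | no _  = ih
  ... | no _   | no _  | yes _ = ≤-trans ih (+-monoʳ-≤ _ (n≤1+n _))
  ... | no _   | yes _ | no _  = m≤n⇒m≤1+n ih
  ... | no _   | yes _ | yes _ = m≤n⇒m≤1+n (≤-trans ih (+-monoʳ-≤ _ (n≤1+n _)))
  ... | yes _  | no _  | yes _ = ≤-trans (s≤s ih) (≤-reflexive (sym (+-suc _ _)))
  ... | yes _  | yes _ | no _  = s≤s ih
  ... | yes _  | yes _ | yes _ = s≤s (≤-trans ih (+-monoʳ-≤ _ (n≤1+n _)))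
  ... | yes px | no ¬q | no ¬r with P⇒Q∪R px
  ...   | inj₁ q = ⊥-elim (¬q q)
  ...   | inj₂ r = ⊥-elim (¬r r)

module _ {A : Set} {P : Pred A ℓ} (P? : Decidable P) where

  length-filter-∷ : ∀ x xs → length (filter P? (x ∷ xs)) ≡ (if does (P? x) then 1 else 0) + length (filter P? xs)
  length-filter-∷ x xs with does (P? x)
  ... | true  = refl
  ... | false = refl

module _ {P : Pred (Subset (suc n)) ℓ} (P? : Decidable P) where

  length-filter-concatMap : ∀ (xs : List (Subset n)) →
    length (filter P? (concatMap (λ v → (outside ∷ v) ∷ (inside ∷ v) ∷ []) xs)) ≡
    length (filter (P? ∘ (outside ∷_)) xs) + length (filter (P? ∘ (inside ∷_)) xs)
  length-filter-concatMap [] = refl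
  length-filter-concatMap (v ∷ xs) = begin
    length (filter P? ((outside ∷ v) ∷ (inside ∷ v) ∷ rest))≡⟨ length-filter-∷ P? _ _ ⟩
    a + length (filter P? ((inside ∷ v) ∷ rest))            ≡⟨ cong (_+_ a) (length-filter-∷ P? _ _) ⟩
    a + (b + length (filter P? rest))                        ≡⟨ cong (λ z → a + (b + z)) (length-filter-concatMap xs) ⟩
    a + (b + (q + r))                                        ≡⟨ +-assoc a b _ ⟨
    (a + b) + (q + r)                                        ≡⟨ interchange a b q r ⟩
    (a + q) + (b + r)                                        ≡⟨ cong₂ _+_ (length-filter-∷ (P? ∘ (outside ∷_)) v xs)
                                                                          (length-filter-∷ (P? ∘ (inside ∷_)) v xs) ⟨
    length (filter (P? ∘ (outside ∷_)) (v ∷ xs)) + length (filter (P? ∘ (inside ∷_)) (v ∷ xs)) ∎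
    where
    open ≡-Reasoning
    rest = concatMap (λ v → (outside ∷ v) ∷ (inside ∷ v) ∷ []) xs
    a = if does (P? (outside ∷ v)) then 1 else 0
    b = if does (P? (inside ∷ v)) then 1 else 0
    q = length (filter (P? ∘ (outside ∷_)) xs)
    r = length (filter (P? ∘ (inside ∷_)) xs)

  opaque
    unfolding #
    #-split : # P? ≡ # (P? ∘ (outside ∷_)) + # (P? ∘ (inside ∷_))
    #-split = length-filter-concatMap (allSubsets n)

module _ {P Q : Pred (Subset n) ℓ} (P? : Decidable P) (Q? : Decidable Q) where
  opaque
    unfolding #

    #-mono : (∀ {S} → P S → Q S) → # P? ≤ # Q?
    #-mono P⇒Q = length-filter-mono P? Q? P⇒Q (allSubsets n)

    #-∪ : {R : Pred (Subset n) ℓ} (R? : Decidable R) → (∀ {S} → P S → Q S ⊎ R S) → # P? ≤ # Q? + # R?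
    #-∪ R? P⇒Q∪R = length-filter-∪ P? Q? R? P⇒Q∪R (allSubsets n)

#-cong : {P Q : Pred (Subset n) ℓ} (P? : Decidable P) (Q? : Decidable Q) → (∀ {S} → P S ⇔ Q S) → # P? ≡ # Q?
#-cong P? Q? P⇔Q = ≤-antisym (#-mono P? Q? (to P⇔Q)) (#-mono Q? P? (from P⇔Q))

opaque
  unfolding #
  #-empty : {P : Pred (Subset n) ℓ} (P? : Decidable P) → (∀ {S} → ¬ P S) → # P? ≡ 0
  #-empty {n = zero}  P? ¬P with P? []
  ... | yes p = ⊥-elim (¬P p)
  ... | no  _ = refl
  #-empty {n = suc n} P? ¬P rewrite #-split P? | #-empty (P? ∘ (outside ∷_)) ¬P | #-empty (P? ∘ (inside ∷_)) ¬P = refl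

#-⋃ : ∀ {m} {P : Pred (Subset n) ℓ} (P? : Decidable P) {Q : Fin m → Pred (Subset n) ℓ} (Q? : ∀ x → Decidable (Q x)) →
      (∀ {S} → P S → ∃[ x ] Q x S) → # P? ≤ ∑[ x < m ] # (Q? x)
#-⋃ {m = zero}  P? Q? cover = ≤-reflexive (#-empty P? (¬Fin0 ∘ proj₁ ∘ cover))
#-⋃ {m = suc m} {P = P} P? {Q} Q? cover =
  ≤-trans (#-∪ P? (Q? zero) P∖Q₀? split)
          (+-monoʳ-≤ (# (Q? zero)) (#-⋃ P∖Q₀? (Q? ∘ suc) cover′))
  where
  P∖Q₀? : Decidable (λ S → P S × ¬ Q zero S)
  P∖Q₀? S = P? S ×-dec ¬? (Q? zero S)
  split : ∀ {S} → P S → Q zero S ⊎ (P S × ¬ Q zero S)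
  split {S} p with Q? zero S
  ... | yes q = inj₁ q
  ... | no ¬q = inj₂ (p , ¬q)
  cover′ : ∀ {S} → P S × ¬ Q zero S → ∃[ x ] Q (suc x) S
  cover′ (p , ¬q) with cover p
  ... | zero  , q = ⊥-elim (¬q q)
  ... | suc x , q = x , q

#-insert : {P : Pred (Subset n) ℓ} (P? : Decidable P) (x : Fin n) →
           # (λ S → x ∈? S ×-dec P? S) ≡ # (λ S → ¬? (x ∈? S) ×-dec P? (S [ x ]≔ inside))
#-insert {suc n} P? zero = begin
  # (λ S → zero ∈? S ×-dec P? S)                                       ≡⟨ #-split _ ⟩
  # (λ S → zero ∈? (outside ∷ S) ×-dec P? (outside ∷ S)) +
  # (λ S → zero ∈? (inside ∷ S) ×-dec P? (inside ∷ S))                 ≡⟨ cong₂ _+_ (#-empty _ λ { (() , _) })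
                                                                                     (#-cong _ _ (mk⇔ proj₂ (here ,_))) ⟩
  0 + # (P? ∘ (inside ∷_))                                              ≡⟨ +-comm 0 _ ⟩
  # (P? ∘ (inside ∷_)) + 0                                              ≡⟨ cong₂ _+_ (#-cong _ _ (mk⇔ proj₂ ((λ ()) ,_)))
                                                                                     (#-empty _ λ (z∉ , _) → z∉ here) ⟨
  # (λ S → ¬? (zero ∈? (outside ∷ S)) ×-dec P? (inside ∷ S)) +
  # (λ S → ¬? (zero ∈? (inside ∷ S)) ×-dec P? (inside ∷ S))             ≡⟨ #-split _ ⟨
  # (λ S → ¬? (zero ∈? S) ×-dec P? (S [ zero ]≔ inside))                ∎
  where open ≡-Reasoning
#-insert {suc n} P? (suc y) = trans (#-split _) (trans (cong₂ _+_ (shift outside) (shift inside)) (sym (#-split _)))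
  where
  shift : ∀ b → # (λ S → suc y ∈? (b ∷ S) ×-dec P? (b ∷ S)) ≡
                # (λ S → ¬? (suc y ∈? (b ∷ S)) ×-dec P? (b ∷ (S [ y ]≔ inside)))
  shift b = begin
    # (λ S → suc y ∈? (b ∷ S) ×-dec P? (b ∷ S))            ≡⟨ #-cong _ _ (mk⇔ (map₁ drop-there) (map₁ there)) ⟩
    # (λ S → y ∈? S ×-dec P? (b ∷ S))                       ≡⟨ #-insert (P? ∘ (b ∷_)) y ⟩
    # (λ S → ¬? (y ∈? S) ×-dec P? (b ∷ (S [ y ]≔ inside)))  ≡⟨ #-cong _ _ (mk⇔ (map₁ (_∘ drop-there)) (map₁ (_∘ there))) ⟩
    # (λ S → ¬? (suc y ∈? (b ∷ S)) ×-dec P? (b ∷ (S [ y ]≔ inside))) ∎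
    where open ≡-Reasoning

#≤∣B∣*maxDegree : {P : Pred (Subset n) ℓ} (P? : Decidable P) (B : Subset n) {D : ℕ} →
                  (∀ {S} → P S → ∃[ x ] x ∈ B × x ∈ S) → (∀ x → # (λ S → x ∈? S ×-dec P? S) ≤ D) →
                  # P? ≤ ∣ B ∣ * D
#≤∣B∣*maxDegree P? B hits degree≤D = ≤-trans
  (#-⋃ P? Q? (λ p → let x , x∈B , x∈S = hits p in x , x∈B , x∈S , p))
  (∑-supported-≤ B (λ x → # (Q? x)) (λ x∉B → #-empty (Q? _) (x∉B ∘ proj₁))
                                   (λ {x} _ → ≤-trans (#-mono (Q? x) _ proj₂) (degree≤D x)))
  where
  Q? = λ x S → x ∈? B ×-dec (x ∈? S ×-dec P? S)

opaque
  unfolding #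

  #≤1-Subset0 : {P : Pred (Subset 0) ℓ} (P? : Decidable P) → # P? ≤ 1
  #≤1-Subset0 P? = length-filter P? (allSubsets 0)

#≤1-if-∣∣≡0 : {P : Pred (Subset n) ℓ} (P? : Decidable P) → (∀ {S} → P S → ∣ S ∣ ≡ 0) → # P? ≤ 1
#≤1-if-∣∣≡0 {n = zero}  P? _      = #≤1-Subset0 P?
#≤1-if-∣∣≡0 {n = suc n} P? P⇒∅ = begin
  # P?                                          ≡⟨ #-split P? ⟩
  # (P? ∘ (outside ∷_)) + # (P? ∘ (inside ∷_))  ≡⟨ cong (_+_ (# (P? ∘ (outside ∷_)))) (#-empty _ (λ p → 1+n≢0 (P⇒∅ p))) ⟩
  # (P? ∘ (outside ∷_)) + 0                     ≡⟨ +-identityʳ _ ⟩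
  # (P? ∘ (outside ∷_))                         ≤⟨ #≤1-if-∣∣≡0 (P? ∘ (outside ∷_)) P⇒∅ ⟩
  1                                             ∎
  where open ≤-Reasoning

size≡∣∣ : (S : Subset n) → size S ≡ ∣ S ∣
size≡∣∣ []            = refl
size≡∣∣ (outside ∷ S) = size≡∣∣ S
size≡∣∣ (inside ∷ S)  = cong suc (size≡∣∣ S)

Monochromatic : ∀ {k} → Coloring n k → Subset n → Fin k → Set
Monochromatic c S a = ∀ {x y} → x ∈ S → y ∈ S → x Fin.< y → c x y ≡ a

MonoClique : ∀ {k} → (Fin k → ℕ) → Coloring n k → Subset n → Set
MonoClique s c S = ∃[ i ] ∣ S ∣ ≡ s i × Monochromatic c S i

T-lookup⇔∈ : ∀ {S : Subset n} {x} → T (lookup S x) ⇔ x ∈ S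
T-lookup⇔∈ {S = S} {x} = mk⇔ (lookup⇒[]= x S ∘ to T-≡) (from T-≡ ∘ []=⇒lookup)

T-if⇔ : ∀ {b c} → T (if b then c else true) ⇔ (T b → T c)
T-if⇔ {true}  = mk⇔ (λ t _ → t) (λ f → f tt)
T-if⇔ {false} = mk⇔ (λ _ ()) (λ _ → tt)

T-all-allFin⇔ : ∀ {f : Fin n → Bool} → T (all f (allFin n)) ⇔ (∀ x → T (f x))
T-all-allFin⇔ {f = f} = mk⇔ (λ t x → All.lookup (All.all⁺ f _ t) (∈-allFin x)) (All.all⁻ f ∘ All.tabulate⁺)

T-any-allFin⇔ : ∀ {f : Fin n → Bool} → T (any f (allFin n)) ⇔ (∃[ x ] T (f x))
T-any-allFin⇔ {n = n} {f = f} = mk⇔ (Any.satisfied ∘ Any.any⁻ f (allFin n)) (λ (x , t) → Any.any⁺ f (Any.tabulate⁺ {f = id} x t))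

T-monoIn⇔ : ∀ {k} (c : Coloring n k) S a → T (monoIn c S a) ⇔ Monochromatic c S a
T-monoIn⇔ c S a = mk⇔ sound complete
  where
  sound : T (monoIn c S a) → Monochromatic c S a
  sound t {x} {y} x∈S y∈S x<y = to (T-does⇔ (c x y ≟ a)) (to T-if⇔ (to T-all-allFin⇔ (to T-all-allFin⇔ t x) y)
    (from T-∧ (from T-lookup⇔∈ x∈S , from T-∧ (from T-lookup⇔∈ y∈S , <⇒<ᵇ x<y))))
  complete : Monochromatic c S a → T (monoIn c S a)
  complete mono = from T-all-allFin⇔ λ x → from T-all-allFin⇔ λ y → from T-if⇔ λ t →
    let x∈S , t′ = to T-∧ t ; y∈S , x<y = to T-∧ t′ in
    from (T-does⇔ (c x y ≟ a)) (mono (to T-lookup⇔∈ x∈S) (to T-lookup⇔∈ y∈S) (<ᵇ⇒< _ _ x<y))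

T-isMonoClique⇔ : ∀ {k} (s : Fin k → ℕ) (c : Coloring n k) S → T (isMonoClique s c S) ⇔ MonoClique s c S
T-isMonoClique⇔ s c S = mk⇔ sound complete
  where
  sound : T (isMonoClique s c S) → MonoClique s c S
  sound t = let i , t′ = to T-any-allFin⇔ t ; size≡ , mono = to T-∧ t′ in
    i , trans (sym (size≡∣∣ S)) (≡ᵇ⇒≡ _ _ size≡) , to (T-monoIn⇔ c S i) mono
  complete : MonoClique s c S → T (isMonoClique s c S)
  complete (i , ∣S∣≡ , mono) = from T-any-allFin⇔
    (i , from T-∧ (≡⇒≡ᵇ _ _ (trans (size≡∣∣ S) ∣S∣≡) , from (T-monoIn⇔ c S i) mono))

monochromatic? : ∀ {k} (c : Coloring n k) S a → Dec (Monochromatic c S a)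
monochromatic? c S a = Dec.map (T-monoIn⇔ c S a) (T? (monoIn c S a))

opaque
  unfolding #

  countMono≡# : ∀ {k} (s : Fin k → ℕ) (c : Coloring n k) → countMono s c ≡ # (T? ∘ isMonoClique s c)
  countMono≡# s c = refl

-- Ceiling division and Turán products

≤/⇔ : ∀ {q a} d → q ≤ a / suc d ⇔ q * suc d ≤ a
≤/⇔ {q} {a} d = mk⇔ (λ q≤ → ≤-trans (*-monoˡ-≤ (suc d) q≤) (m/n*n≤m a (suc d)))
                    (λ ≤a → subst (_≤ a / suc d) (m*n/n≡m q (suc d)) (/-monoˡ-≤ (suc d) ≤a))

⌈_/_⌉ : ℕ → ℕ → ℕ
⌈ x / zero  ⌉ = 0
⌈ x / suc d ⌉ = (x + d) / suc d

<⌈/⌉⇔ : ∀ {m x} d → m < ⌈ x / suc d ⌉ ⇔ m * suc d < x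
<⌈/⌉⇔ {m} {x} d = mk⇔
  (λ m< → +-cancelʳ-≤ d _ _ (subst (_≤ x + d) (cong suc (+-comm d (m * suc d))) (to (≤/⇔ d) m<)))
  (λ <x → from (≤/⇔ d) (subst (_≤ x + d) (cong suc (+-comm (m * suc d) d)) (+-monoˡ-≤ d <x)))

⌈/⌉≤⇔ : ∀ {m x} d → ⌈ x / suc d ⌉ ≤ m ⇔ x ≤ m * suc d
⌈/⌉≤⇔ {m} {x} d = mk⇔ (λ ⌈⌉≤ → ≮⇒≥ (λ <x → <⇒≱ (from (<⌈/⌉⇔ d) <x) ⌈⌉≤))
                       (λ x≤ → ≮⇒≥ (λ m< → <⇒≱ (to (<⌈/⌉⇔ d) m<) x≤))

⌈x/d⌉≤x : ∀ x d → ⌈ x / suc d ⌉ ≤ x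
⌈x/d⌉≤x x d = from (⌈/⌉≤⇔ d) (m≤m*n x (suc d))

⌈x/1⌉≡x : ∀ x → ⌈ x / 1 ⌉ ≡ x
⌈x/1⌉≡x x = trans (n/1≡n (x + 0)) (+-identityʳ x)

-- The number of K_t's in the Turán graph T(n, t): the product of the part sizes of the balanced
-- t-partition of n, largest part first.
turán : ℕ → ℕ → ℕ
turán n zero    = 1
turán n (suc t) = ⌈ n / suc t ⌉ * turán (n ∸ ⌈ n / suc t ⌉) t

⌈/⌉-between : ∀ a b t → let q = ⌈ a / suc t ⌉ ; m = ⌈ (a + b) / suc (suc t) ⌉ in
              (b ≤ m × m ≤ q) ⊎ (q ≤ m × m ≤ b)
⌈/⌉-between a b t with ⌈ a / suc t ⌉ ≤? b
... | yes q≤b = inj₂ (q≤m , m≤b)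
  where
  open ≤-Reasoning
  q = ⌈ a / suc t ⌉
  m = ⌈ (a + b) / suc (suc t) ⌉
  m≤b : m ≤ b
  m≤b = from (⌈/⌉≤⇔ (suc t)) (begin
    a + b               ≡⟨ +-comm a b ⟩
    b + a               ≤⟨ +-monoʳ-≤ b (to (⌈/⌉≤⇔ t) q≤b) ⟩
    b + b * suc t       ≡⟨ *-suc b (suc t) ⟨
    b * suc (suc t)     ∎)
  q≤m : q ≤ m
  q≤m = from (⌈/⌉≤⇔ t) (+-cancelˡ-≤ b a _ (begin
    b + a               ≡⟨ +-comm b a ⟩
    a + b               ≤⟨ to (⌈/⌉≤⇔ (suc t)) ≤-refl ⟩
    m * suc (suc t)     ≡⟨ *-suc m (suc t) ⟩
    m + m * suc t       ≤⟨ +-monoˡ-≤ (m * suc t) m≤b ⟩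
    b + m * suc t       ∎))
... | no q≰b = inj₁ (b≤m , m≤q)
  where
  open ≤-Reasoning
  q = ⌈ a / suc t ⌉
  m = ⌈ (a + b) / suc (suc t) ⌉
  bt<a : b * suc t < a
  bt<a = to (<⌈/⌉⇔ t) (≰⇒> q≰b)
  m≤q : m ≤ q
  m≤q = from (⌈/⌉≤⇔ (suc t)) (begin
    a + b               ≤⟨ +-mono-≤ (to (⌈/⌉≤⇔ t) ≤-refl) (<⇒≤ (≰⇒> q≰b)) ⟩
    q * suc t + q       ≡⟨ +-comm (q * suc t) q ⟩
    q + q * suc t       ≡⟨ *-suc q (suc t) ⟨
    q * suc (suc t)     ∎)
  b≤m : b ≤ m
  b≤m = from (≤/⇔ (suc t)) (begin
    b * suc (suc t)     ≡⟨ *-suc b (suc t) ⟩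
    b + b * suc t       ≤⟨ +-monoʳ-≤ b (<⇒≤ bt<a) ⟩
    b + a               ≡⟨ +-comm b a ⟩
    a + b               ≤⟨ m≤m+n (a + b) (suc t) ⟩
    a + b + suc t       ∎)

*≤*[+∸] : ∀ {x m y} → x ≤ m → m ≤ y → x * y ≤ m * (x + y ∸ m)
*≤*[+∸] {x} x≤m m≤y with u , refl ← m≤n⇒∃[o]m+o≡n x≤m | v , refl ← m≤n⇒∃[o]m+o≡n m≤y = begin
  x * (x + u + v)                        ≤⟨ m≤m+n _ (u * v) ⟩
  x * (x + u + v) + u * v                ≡⟨ expand x u v ⟩
  (x + u) * (x + v)                      ≡⟨ cong ((x + u) *_) (m+n∸n≡m (x + v) (x + u)) ⟨
  (x + u) * (x + v + (x + u) ∸ (x + u))  ≡⟨ cong (λ z → (x + u) * (z ∸ (x + u))) (shuffle x u v) ⟩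
  (x + u) * (x + (x + u + v) ∸ (x + u))  ∎
  where
  open ≤-Reasoning
  expand : ∀ x u v → x * (x + u + v) + u * v ≡ (x + u) * (x + v)
  expand = solve-∀
  shuffle : ∀ x u v → x + v + (x + u) ≡ x + (x + u + v)
  shuffle = solve-∀

*-turán≤turán : ∀ t a b → b * turán a t ≤ turán (a + b) (suc t)
*-turán≤turán zero    a b = begin
  b * 1               ≤⟨ *-monoˡ-≤ 1 (m≤n+m b a) ⟩
  (a + b) * 1         ≡⟨ cong (_* 1) (⌈x/1⌉≡x (a + b)) ⟨
  ⌈ (a + b) / 1 ⌉ * 1 ∎
  where open ≤-Reasoning
*-turán≤turán (suc t) a b = begin
  b * (q * turán a′ t)          ≡⟨ *-assoc b q _ ⟨
  (b * q) * turán a′ t          ≤⟨ *-monoˡ-≤ (turán a′ t) bq≤mb′ ⟩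
  (m * b′) * turán a′ t         ≡⟨ *-assoc m b′ _ ⟩
  m * (b′ * turán a′ t)         ≤⟨ *-monoʳ-≤ m (*-turán≤turán t a′ b′) ⟩
  m * turán (a′ + b′) (suc t)   ≡⟨ cong (λ z → m * turán z (suc t)) a′+b′≡a+b∸m ⟩
  m * turán (a + b ∸ m) (suc t) ∎
  where
  open ≤-Reasoning
  q = ⌈ a / suc t ⌉
  m = ⌈ (a + b) / suc (suc t) ⌉
  a′ = a ∸ q
  b′ = b + q ∸ m
  bq≤mb′ : b * q ≤ m * b′
  bq≤mb′ with ⌈/⌉-between a b t
  ... | inj₁ (b≤m , m≤q) = *≤*[+∸] b≤m m≤q
  ... | inj₂ (q≤m , m≤b) = subst₂ (λ u v → u ≤ m * (v ∸ m)) (*-comm q b) (+-comm q b) (*≤*[+∸] q≤m m≤b)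
  m≤b+q : m ≤ b + q
  m≤b+q with ⌈/⌉-between a b t
  ... | inj₁ (_ , m≤q) = ≤-trans m≤q (m≤n+m q b)
  ... | inj₂ (_ , m≤b) = ≤-trans m≤b (m≤m+n b q)
  a′+b′≡a+b∸m : a′ + b′ ≡ a + b ∸ m
  a′+b′≡a+b∸m = begin-equality
    a ∸ q + (b + q ∸ m)   ≡⟨ +-∸-assoc (a ∸ q) m≤b+q ⟨
    a ∸ q + (b + q) ∸ m   ≡⟨ cong (_∸ m) (+-assoc (a ∸ q) b q) ⟨
    a ∸ q + b + q ∸ m     ≡⟨ cong (_∸ m) (+-comm (a ∸ q + b) q) ⟩
    q + (a ∸ q + b) ∸ m   ≡⟨ cong (_∸ m) (+-assoc q (a ∸ q) b) ⟨
    q + (a ∸ q) + b ∸ m   ≡⟨ cong (λ z → z + b ∸ m) (m+[n∸m]≡n (⌈x/d⌉≤x a t)) ⟩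
    a + b ∸ m             ∎

⌈/⌉-tail : ∀ n s j → ⌈ (n ∸ ⌈ n / suc (suc s) ⌉ ∸ j) / suc s ⌉ ≤ ⌈ (n ∸ suc j) / suc (suc s) ⌉
⌈/⌉-tail n s j with n ∸ ⌈ n / suc (suc s) ⌉ ∸ j in x≡
... | zero    = ≤-trans (⌈x/d⌉≤x 0 s) z≤n
... | suc x′ = from (≤/⇔ (suc s)) (begin
  L * suc (suc s)        ≡⟨ *-suc L (suc s) ⟩
  L + L * suc s          ≤⟨ +-monoʳ-≤ L (to (≤/⇔ s) ≤-refl) ⟩
  L + (suc x′ + s)       ≤⟨ +-monoˡ-≤ (suc x′ + s) L≤c ⟩
  c + (suc x′ + s)       ≡⟨ shuffle c x′ s ⟩
  x′ + c + suc s         ≡⟨ cong (_+ suc s) n∸suc[j]≡x′+c ⟨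
  n ∸ suc j + suc s      ∎)
  where
  open ≤-Reasoning
  c = ⌈ n / suc (suc s) ⌉
  L = ⌈ suc x′ / suc s ⌉
  shuffle : ∀ c x′ s → c + (suc x′ + s) ≡ x′ + c + suc s
  shuffle = solve-∀
  n∸[c+j]≡1+x′ : n ∸ (c + j) ≡ suc x′
  n∸[c+j]≡1+x′ = trans (sym (∸-+-assoc n c j)) x≡
  n≡ : n ≡ x′ + c + suc j
  n≡ = begin-equality
    n                    ≡⟨ m∸n+n≡m {n} {c + j} (<⇒≤ (m∸n≢0⇒n<m (λ eq → 1+n≢0 (trans (sym n∸[c+j]≡1+x′) eq)))) ⟨
    n ∸ (c + j) + (c + j) ≡⟨ cong (_+ (c + j)) n∸[c+j]≡1+x′ ⟩
    suc x′ + (c + j)     ≡⟨ rearrange x′ c j ⟩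
    x′ + c + suc j       ∎
    where
    rearrange : ∀ x′ c j → suc x′ + (c + j) ≡ x′ + c + suc j
    rearrange = solve-∀
  n∸suc[j]≡x′+c : n ∸ suc j ≡ x′ + c
  n∸suc[j]≡x′+c = trans (cong (_∸ suc j) n≡) (m+n∸n≡m (x′ + c) (suc j))
  L≤c : L ≤ c
  L≤c = from (⌈/⌉≤⇔ s) (+-cancelˡ-≤ c _ _ (begin
    c + suc x′           ≤⟨ m≤m+n (c + suc x′) j ⟩
    c + suc x′ + j       ≡⟨ rearrange c x′ j ⟩
    x′ + c + suc j       ≡⟨ n≡ ⟨
    n                    ≤⟨ to (⌈/⌉≤⇔ (suc s)) ≤-refl ⟩
    c * suc (suc s)      ≡⟨ *-suc c (suc s) ⟩
    c + c * suc s        ∎))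
    where
    rearrange : ∀ c x′ j → c + suc x′ + j ≡ x′ + c + suc j
    rearrange = solve-∀

-- Cliques in a colour class

maximiser : ∀ {n} (f : Fin n → ℕ) → Fin n → ∃[ v ] (∀ x → f x ≤ f v)
maximiser {n} f x₀ = argmax f x₀ (allFin n) , λ x → All.lookup (f[xs]≤f[argmax] x₀ (allFin n)) (∈-allFin x)

module _ {n k} (c : Coloring n k) (i : Fin k) where

  Adjacent : Fin n → Fin n → Set
  Adjacent x y = (x Fin.< y × c x y ≡ i) ⊎ (y Fin.< x × c y x ≡ i)

  adjacent? : ∀ x y → Dec (Adjacent x y)
  adjacent? x y = (x Fin.<? y ×-dec c x y ≟ i) ⊎-dec (y Fin.<? x ×-dec c y x ≟ i)

  ¬Adjacent-refl : ∀ {x} → ¬ Adjacent x x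
  ¬Adjacent-refl (inj₁ (x<x , _)) = <-irrefl refl x<x
  ¬Adjacent-refl (inj₂ (x<x , _)) = <-irrefl refl x<x

  nbhd : Fin n → Subset n
  nbhd v = setOf (adjacent? v)

  monochromatic-insert : ∀ {S v} → Monochromatic c S i → (∀ {x} → x ∈ S → Adjacent v x) →
                         Monochromatic c (S [ v ]≔ inside) i
  monochromatic-insert {S} {v} mono adj {x} {y} x∈ y∈ x<y with ∈-insert⁻ S v x∈ | ∈-insert⁻ S v y∈
  ... | inj₁ refl | inj₁ refl = ⊥-elim (<-irrefl refl x<y)
  ... | inj₁ refl | inj₂ y∈S with adj y∈S
  ...   | inj₁ (_ , cvy≡i)   = cvy≡i
  ...   | inj₂ (y<v , _)     = ⊥-elim (<-asym x<y y<v)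
  monochromatic-insert {S} {v} mono adj {x} {y} x∈ y∈ x<y | inj₂ x∈S | inj₁ refl with adj x∈S
  ...   | inj₁ (v<x , _)     = ⊥-elim (<-asym x<y v<x)
  ...   | inj₂ (_ , cxv≡i)   = cxv≡i
  monochromatic-insert {S} {v} mono adj {x} {y} x∈ y∈ x<y | inj₂ x∈S | inj₂ y∈S = mono x∈S y∈S x<y

  monochromatic-insert⁻ : ∀ {S v x} → Monochromatic c (S [ v ]≔ inside) i → v ∉ S → x ∈ S → Adjacent v x
  monochromatic-insert⁻ {S} {v} {x} mono v∉S x∈S with Fin.<-cmp v x
  ... | tri< v<x _ _ = inj₁ (v<x , mono (x∈insert S v) (∈-insert⁺ S v x∈S) v<x)
  ... | tri≈ _ refl _ = ⊥-elim (v∉S x∈S)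
  ... | tri> _ _ x<v = inj₂ (x<v , mono (∈-insert⁺ S v x∈S) (x∈insert S v) x<v)

  IsClique : Subset n → ℕ → Subset n → Set
  IsClique A t S = S ⊆ A × ∣ S ∣ ≡ t × Monochromatic c S i

  isClique? : ∀ A t → Decidable (IsClique A t)
  isClique? A t S = S ⊆? A ×-dec (∣ S ∣ ℕ.≟ t ×-dec monochromatic? c S i)

  CliqueFree : Subset n → ℕ → Set
  CliqueFree A t = ∀ {S} → ¬ IsClique A t S

  cliques : Subset n → ℕ → ℕ
  cliques A t = # (isClique? A t)

  degree : Subset n → ℕ → Fin n → ℕ
  degree A t x = # (λ S → x ∈? S ×-dec isClique? A t S)

  clique-insert : ∀ {A t S v} → v ∈ A → IsClique (A ∩ nbhd v) t S → IsClique A (suc t) (S [ v ]≔ inside)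
  clique-insert {A} {t} {S} {v} v∈A (S⊆N , ∣S∣≡t , mono) = S′⊆A , trans (∣∣-insert S v v∉S) (cong suc ∣S∣≡t) ,
    monochromatic-insert mono (∈-setOf⁻ (adjacent? v) ∘ proj₂ ∘ x∈p∩q⁻ A (nbhd v) ∘ S⊆N)
    where
    v∉S : v ∉ S
    v∉S = ¬Adjacent-refl ∘ ∈-setOf⁻ (adjacent? v) ∘ proj₂ ∘ x∈p∩q⁻ A (nbhd v) ∘ S⊆N
    S′⊆A : S [ v ]≔ inside ⊆ A
    S′⊆A x∈ with ∈-insert⁻ S v x∈
    ... | inj₁ refl = v∈A
    ... | inj₂ x∈S  = proj₁ (x∈p∩q⁻ A (nbhd v) (S⊆N x∈S))

  degree≤cliques-nbhd : ∀ A t v → degree A (suc t) v ≤ cliques (A ∩ nbhd v) t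
  degree≤cliques-nbhd A t v = ≤-trans (≤-reflexive (#-insert (isClique? A (suc t)) v)) (#-mono _ (isClique? (A ∩ nbhd v) t) shrink)
    where
    shrink : ∀ {S} → v ∉ S × IsClique A (suc t) (S [ v ]≔ inside) → IsClique (A ∩ nbhd v) t S
    shrink {S} (v∉S , S′⊆A , ∣S′∣≡ , mono) =
      (λ x∈S → x∈p∩q⁺ (S′⊆A (∈-insert⁺ S v x∈S) , ∈-setOf⁺ (adjacent? v) (monochromatic-insert⁻ mono v∉S x∈S))) ,
      ℕ.suc-injective (trans (sym (∣∣-insert S v v∉S)) ∣S′∣≡) ,
      (λ x∈S y∈S → mono (∈-insert⁺ S v x∈S) (∈-insert⁺ S v y∈S))

  -- Zykov: every (t+1)-clique meets the non-neighbours B of v in A (else it extends by v), and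
  -- each vertex of B lies in at most degree v ≤ cliques (A ∩ nbhd v) t of them.
  cliques≤∣B∣*cliques-nbhd : ∀ {t} A {v} → CliqueFree A (suc (suc t)) → v ∈ A →
                       (∀ x → degree A (suc t) x ≤ degree A (suc t) v) →
                       cliques A (suc t) ≤ ∣ A ∩ ∁ (nbhd v) ∣ * cliques (A ∩ nbhd v) t
  cliques≤∣B∣*cliques-nbhd {t} A {v} free v∈A degree≤ = ≤-trans
    (#≤∣B∣*maxDegree (isClique? A (suc t)) B hitsB degree≤)
    (*-monoʳ-≤ ∣ B ∣ (degree≤cliques-nbhd A t v))
    where
    N = A ∩ nbhd v
    B = A ∩ ∁ (nbhd v)
    hitsB : ∀ {S} → IsClique A (suc t) S → ∃[ x ] x ∈ B × x ∈ S
    hitsB {S} (S⊆A , rest) = byCases (nonempty? (S ∩ B))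
      where
      byCases : Dec (∃[ x ] x ∈ S ∩ B) → ∃[ x ] x ∈ B × x ∈ S
      byCases (yes (x , x∈S∩B)) = let x∈S , x∈B = x∈p∩q⁻ S B x∈S∩B in x , x∈B , x∈S
      byCases (no S∩B=∅) = ⊥-elim (free (clique-insert v∈A (S⊆N , rest)))
        where
        S⊆N : S ⊆ N
        S⊆N {x} x∈S with x ∈? nbhd v
        ... | yes x∈N = x∈p∩q⁺ (S⊆A x∈S , x∈N)
        ... | no x∉N  = ⊥-elim (S∩B=∅ (x , x∈p∩q⁺ (x∈S , x∈p∩q⁺ (S⊆A x∈S , x∉p⇒x∈∁p x∉N))))

  cliques≡0 : ∀ {t} A → (∀ x → degree A (suc t) x ≤ 0) → cliques A (suc t) ≡ 0
  cliques≡0 {t} A degree≤0 = n≤0⇒n≡0 (≤-trans (#≤∣B∣*maxDegree (isClique? A (suc t)) A hitsA degree≤0)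
                                               (≤-reflexive (*-zeroʳ ∣ A ∣)))
    where
    hitsA : ∀ {S} → IsClique A (suc t) S → ∃[ x ] x ∈ A × x ∈ S
    hitsA {S} (S⊆A , ∣S∣≡ , _) = let x , x∈S = ∣∣>0⇒nonempty S (subst (0 <_) (sym ∣S∣≡) z<s) in x , S⊆A x∈S , x∈S

  cliques-step : ∀ {t} A → CliqueFree A (suc (suc t)) →
                 (∀ A′ → CliqueFree A′ (suc t) → cliques A′ t ≤ turán ∣ A′ ∣ t) →
                 cliques A (suc t) ≤ turán ∣ A ∣ (suc t)
  cliques-step {t} A free IH = byCliques (anySubset? (isClique? A (suc t)))
    where
    open ℕ.≤-Reasoning
    byMembership : ∀ {v} → (∀ x → degree A (suc t) x ≤ degree A (suc t) v) → Dec (v ∈ A) →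
                   cliques A (suc t) ≤ turán ∣ A ∣ (suc t)
    byMembership {v} degree≤ (no v∉A) = ≤-trans (≤-reflexive (cliques≡0 A λ x → ≤-trans (degree≤ x) degree[v]≤0)) z≤n
      where
      degree[v]≤0 : degree A (suc t) v ≤ 0
      degree[v]≤0 = ≤-reflexive (#-empty _ (λ (v∈S , S⊆A , _) → v∉A (S⊆A v∈S)))
    byMembership {v} degree≤ (yes v∈A) = begin
      cliques A (suc t)              ≤⟨ cliques≤∣B∣*cliques-nbhd A free v∈A degree≤ ⟩
      ∣ B ∣ * cliques N t            ≤⟨ *-monoʳ-≤ ∣ B ∣ (IH N (free ∘ clique-insert v∈A)) ⟩
      ∣ B ∣ * turán (∣ N ∣) t        ≤⟨ *-turán≤turán t (∣ N ∣) (∣ B ∣) ⟩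
      turán (∣ N ∣ + ∣ B ∣) (suc t)  ≡⟨ cong (λ a → turán a (suc t)) (∣p∩q∣+∣p∩∁q∣≡∣p∣ A (nbhd v)) ⟩
      turán (∣ A ∣) (suc t)          ∎
      where
      N = A ∩ nbhd v
      B = A ∩ ∁ (nbhd v)
    byCliques : Dec (∃[ S ] IsClique A (suc t) S) → cliques A (suc t) ≤ turán ∣ A ∣ (suc t)
    byCliques (no ∄clique) = ≤-trans (≤-reflexive (#-empty (isClique? A (suc t)) (∄clique ∘ (_ ,_)))) z≤n
    byCliques (yes (S , _ , ∣S∣≡ , _)) =
      let x₀ , _ = ∣∣>0⇒nonempty S (subst (0 <_) (sym ∣S∣≡) z<s)
          v , degree≤ = maximiser (degree A (suc t)) x₀
      in byMembership degree≤ (v ∈? A)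

  cliques≤turán : ∀ t A → CliqueFree A (suc t) → cliques A t ≤ turán ∣ A ∣ t
  cliques≤turán zero    A _    = #≤1-if-∣∣≡0 (isClique? A 0) (proj₁ ∘ proj₂)
  cliques≤turán (suc t) A free = cliques-step A free (cliques≤turán t)

-- Duplicating a vertex

-- The new vertex 0 is a copy of the old vertex 0 (now 1); the edge between the copies gets colour i.
duplicate : ∀ {n k} → Coloring (suc n) k → Fin k → Coloring (suc (suc n)) k
duplicate c i (suc x) (suc y)       = c x y
duplicate c i zero    (suc (suc y)) = c zero (suc y)
duplicate c i _       _             = i

module _ {n k} (s : Fin k → ℕ) (c : Coloring (suc n) k) (good : ∀ {S} → ¬ MonoClique s c S) (i : Fin k) where

  private
    c′ = duplicate c i
    N = nbhd c i zero

  ¬MonoClique-outside : ∀ {S} → ¬ MonoClique s c′ (outside ∷ S)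
  ¬MonoClique-outside (j , ∣S∣≡ , mono) = good (j , ∣S∣≡ , λ x∈ y∈ x<y → mono (there x∈) (there y∈) (s<s x<y))

  ¬MonoClique-inside-outside : ∀ {S} → ¬ MonoClique s c′ (inside ∷ outside ∷ S)
  ¬MonoClique-inside-outside {S} (j , ∣S∣≡ , mono) = good (j , ∣S∣≡ , mono′)
    where
    mono′ : Monochromatic c (inside ∷ S) j
    mono′ here        (there y∈) _         = mono here (there (there y∈)) z<s
    mono′ (there x∈)  (there y∈) (s<s x<y) = mono (there (there x∈)) (there (there y∈)) (s<s (s<s x<y))

  clique-of-MonoClique-inside-inside : ∀ {S} → MonoClique s c′ (inside ∷ inside ∷ S) → IsClique c i N (s i ∸ 2) (outside ∷ S)
  clique-of-MonoClique-inside-inside {S} (j , ∣S∣+2≡ , mono) = S⊆N , ∣S∣≡ , mono′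
    where
    j≡i : j ≡ i
    j≡i = sym (mono here (there here) z<s)
    S⊆N : outside ∷ S ⊆ N
    S⊆N (there y∈) = ∈-setOf⁺ (adjacent? c i zero) (inj₁ (z<s , trans (mono here (there (there y∈)) z<s) j≡i))
    ∣S∣≡ : ∣ S ∣ ≡ s i ∸ 2
    ∣S∣≡ = cong (_∸ 2) (trans ∣S∣+2≡ (cong s j≡i))
    mono′ : Monochromatic c (outside ∷ S) i
    mono′ (there x∈) (there y∈) (s<s x<y) = trans (mono (there (there x∈)) (there (there y∈)) (s<s (s<s x<y))) j≡i

  nbhd-cliqueFree : 2 ≤ s i → CliqueFree c i N (suc (s i ∸ 2))
  nbhd-cliqueFree 2≤sᵢ {inside ∷ S}  (S⊆N , _) = ¬Adjacent-refl c i (∈-setOf⁻ (adjacent? c i zero) (S⊆N here))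
  nbhd-cliqueFree 2≤sᵢ {outside ∷ S} (S⊆N , ∣S∣≡ , mono) =
    good (i , trans (cong suc ∣S∣≡) (m+[n∸m]≡n 2≤sᵢ) , mono′)
    where
    mono′ : Monochromatic c (inside ∷ S) i
    mono′ here       (there y∈) _   with ∈-setOf⁻ (adjacent? c i zero) (S⊆N (there y∈))
    ... | inj₁ (_ , c0y≡i) = c0y≡i
    ... | inj₂ (() , _)
    mono′ (there x∈) (there y∈) x<y = mono (there x∈) (there y∈) x<y

  countMono-duplicate≤ : countMono s c′ ≤ cliques c i N (s i ∸ 2)
  countMono-duplicate≤ = begin
    countMono s c′                                        ≡⟨ countMono≡# s c′ ⟩
    # P?                                                  ≡⟨ #-split P? ⟩
    # (P? ∘ (outside ∷_)) + # (P? ∘ (inside ∷_))          ≡⟨ cong₂ _+_ (#-empty _ (λ {S} → ¬T-outside {S}))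
                                                                         (#-split (P? ∘ (inside ∷_))) ⟩
    0 + (# (λ S → P? (inside ∷ outside ∷ S)) + # P?₁₁)    ≡⟨ cong (λ z → 0 + (z + # P?₁₁))
                                                                    (#-empty _ (λ {S} → ¬T-inside-outside {S})) ⟩
    0 + (0 + # P?₁₁)                                      ≤⟨ #-mono _ _ (λ {S} → clique-of-T-inside-inside {S}) ⟩
    # (λ S → isClique? c i N t (outside ∷ S))             ≤⟨ m≤m+n _ _ ⟩
    # (λ S → isClique? c i N t (outside ∷ S)) + # (λ S → isClique? c i N t (inside ∷ S))
                                                          ≡⟨ #-split (isClique? c i N t) ⟨
    cliques c i N t                                       ∎
    where
    open ≤-Reasoning
    t = s i ∸ 2
    P? = T? ∘ isMonoClique s c′
    P?₁₁ = λ S → P? (inside ∷ inside ∷ S)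
    mono : ∀ {S} → T (isMonoClique s c′ S) → MonoClique s c′ S
    mono {S} = to (T-isMonoClique⇔ s c′ S)
    ¬T-outside : ∀ {S} → ¬ T (isMonoClique s c′ (outside ∷ S))
    ¬T-outside {S} = ¬MonoClique-outside ∘ mono {outside ∷ S}
    ¬T-inside-outside : ∀ {S} → ¬ T (isMonoClique s c′ (inside ∷ outside ∷ S))
    ¬T-inside-outside {S} = ¬MonoClique-inside-outside ∘ mono {inside ∷ outside ∷ S}
    clique-of-T-inside-inside : ∀ {S} → T (isMonoClique s c′ (inside ∷ inside ∷ S)) → IsClique c i N t (outside ∷ S)
    clique-of-T-inside-inside {S} = clique-of-MonoClique-inside-inside ∘ mono {inside ∷ inside ∷ S}

-- A lower bound for the Ramsey number

-- Blocks of k consecutive vertices.  Edges between blocks get colour i; inside a block the edge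
-- xy with x < y gets a colour ≠ i determined by the position of x.  So a colour-i clique has at
-- most one vertex per block, and every other colour class is triangle-free.
module BlockColouring {k′ : ℕ} (i : Fin (suc k′)) where

  private
    k = suc k′

  block position : Fin n → ℕ
  block x    = toℕ x / k
  position x = toℕ x % k

  blockColouring : Coloring n k
  blockColouring x y with block x ℕ.≟ block y | position x <? k′
  ... | yes _ | yes p<k′ = punchIn i (fromℕ< p<k′)
  ... | _     | _        = i

  position-< : ∀ {x y : Fin n} → block x ≡ block y → x Fin.< y → position x < position y
  position-< {x = x} {y} same x<y = +-cancelʳ-< (block x * k) (position x) (position y)
    (subst₂ _<_ (m≡m%n+[m/n]*n (toℕ x) k) (trans (m≡m%n+[m/n]*n (toℕ y) k) (cong (λ b → position y + b * k) (sym same))) x<y)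

  block-< : ∀ {x y : Fin n} → x Fin.< y → blockColouring x y ≡ i → block x < block y
  block-< {x = x} {y} x<y colour≡i with block x ℕ.≟ block y | position x <? k′
  ... | yes _    | yes _  = ⊥-elim (punchInᵢ≢i i _ colour≡i)
  ... | yes same | no p≮k′ = ⊥-elim (p≮k′ (<-≤-trans (position-< same x<y) (s≤s⁻¹ (m%n<n (toℕ y) k))))
  ... | no diff  | _      = ≤∧≢⇒< (/-monoˡ-≤ k (<⇒≤ x<y)) diff

  same-position : ∀ {x y z : Fin n} {j} → x Fin.< y → y Fin.< z → blockColouring x y ≡ j → blockColouring y z ≡ j → j ≢ i →
                  block x ≡ block y × position x ≡ position y
  same-position {x = x} {y} {z} x<y y<z xy≡j yz≡j j≢i
    with block x ℕ.≟ block y | position x <? k′ | block y ℕ.≟ block z | position y <? k′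
  ... | yes same | yes p<k′ | yes _ | yes q<k′ =
    same , trans (sym (toℕ-fromℕ< p<k′)) (trans (cong toℕ (punchIn-injective i _ _ (trans xy≡j (sym yz≡j)))) (toℕ-fromℕ< q<k′))
  ... | yes _ | yes _  | yes _ | no _  = ⊥-elim (j≢i (sym yz≡j))
  ... | yes _ | yes _  | no _  | _     = ⊥-elim (j≢i (sym yz≡j))
  ... | yes _ | no _   | _     | _     = ⊥-elim (j≢i (sym xy≡j))
  ... | no _  | _      | _     | _     = ⊥-elim (j≢i (sym xy≡j))

  blockColouring-noMonoClique : ∀ {n} (s : Fin k → ℕ) → (∀ j → 3 ≤ s j) → n ≤ k * (s i ∸ 3) + 2 →
                                ∀ {S : Subset n} → ¬ MonoClique s blockColouring S
  blockColouring-noMonoClique {n} s s≥3 n≤ {S} (j , ∣S∣≡ , mono) with j Fin.≟ i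
  ... | yes refl = <-irrefl refl (begin-strict
    s i      ≡⟨ ∣S∣≡ ⟨
    ∣ S ∣    ≤⟨ ∣S∣≤ ⟩
    s i ∸ 1  <⟨ ∸-monoʳ-< {o = 0} z<s (≤-trans (s≤s z≤n) (s≥3 i)) ⟩
    s i      ∎)
    where
    open ≤-Reasoning
    block<s∸1 : ∀ (x : Fin n) → block x < s i ∸ 1
    block<s∸1 x = m<n*o⇒m/o<n (<-≤-trans (toℕ<n x) (≤-trans n≤ (blocks≤ (s i) (s≥3 i))))
      where
      blocks≤ : ∀ m → 3 ≤ m → k * (m ∸ 3) + 2 ≤ (m ∸ 1) * k
      blocks≤ (suc (suc (suc u))) _ = subst (k * u + 2 ≤_) (sym (expand u k′)) (m≤m+n (k * u + 2) (2 * k′))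
        where
        expand : ∀ u k′ → (2 + u) * suc k′ ≡ suc k′ * u + 2 + 2 * k′
        expand = solve-∀
      blocks≤ 0                 ()
      blocks≤ 1                 (s≤s ())
      blocks≤ 2                 (s≤s (s≤s ()))
    ∣S∣≤ : ∣ S ∣ ≤ s i ∸ 1
    ∣S∣≤ = ∣∣≤-strictlyIncreasing S block (λ {x} _ → z≤n , block<s∸1 x) (λ x∈ y∈ x<y → block-< x<y (mono x∈ y∈ x<y))
  ... | no j≢i with three∈ S (subst (3 ≤_) (sym ∣S∣≡) (s≥3 j))
  ... | x , y , z , x∈S , y∈S , z∈S , x<y , y<z with same-position x<y y<z (mono x∈S y∈S x<y) (mono y∈S z∈S y<z) j≢i
  ... | same-block , same-pos = <-irrefl x≡y x<y
    where
    x≡y : toℕ x ≡ toℕ y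
    x≡y = trans (m≡m%n+[m/n]*n (toℕ x) k) (trans (cong₂ (λ p b → p + b * k) same-pos same-block) (sym (m≡m%n+[m/n]*n (toℕ y) k)))

ramsey-lower-bound : ∀ {k′ n} (s : Fin (suc k′) → ℕ) → (∀ j → 3 ≤ s j) → Arrows n (suc k′) s →
                     ∀ i → suc k′ * (s i ∸ 3) + 2 < n
ramsey-lower-bound s s≥3 arrows i = ≰⇒> λ n≤ →
  let open BlockColouring i ; S , isMono = arrows blockColouring in
  blockColouring-noMonoClique s s≥3 n≤ (to (T-isMonoClique⇔ s blockColouring S) (from T-≡ isMono))

-- The factors of the bound

⌊⌋*↧≤↥ : ∀ p → ℚ.⌊ p ⌋ ℤ.* ↧ p ℤ.≤ ↥ p
⌊⌋*↧≤↥ p@record{} = ℤ.[n/d]*d≤n (↥ p) (↧ p)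

↥≤⌈⌉*↧ : ∀ p → ↥ p ℤ.≤ ℚ.⌈ p ⌉ ℤ.* ↧ p
↥≤⌈⌉*↧ p@record{} = begin
  ↥ p                          ≡⟨ ℤ.neg-involutive (↥ p) ⟨
  ℤ.- (ℤ.- ↥ p)                ≤⟨ ℤ.neg-mono-≤ ⌊-p⌋*↧p≤-↥p ⟩
  ℤ.- (ℚ.⌊ ℚ.- p ⌋ ℤ.* ↧ p)    ≡⟨ ℤ.neg-distribˡ-* ℚ.⌊ ℚ.- p ⌋ (↧ p) ⟩
  ℚ.⌈ p ⌉ ℤ.* ↧ p              ∎
  where
  open ℤ.≤-Reasoning
  ⌊-p⌋*↧p≤-↥p : ℚ.⌊ ℚ.- p ⌋ ℤ.* ↧ p ℤ.≤ ℤ.- ↥ p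
  ⌊-p⌋*↧p≤-↥p = subst₂ (λ d n → ℚ.⌊ ℚ.- p ⌋ ℤ.* d ℤ.≤ n) (ℚ.↧-neg p) (ℚ.↥-neg p) (⌊⌋*↧≤↥ (ℚ.- p))

suc≤⌈⌉ : ∀ z p → mkℚᵘ z 0 ℚᵘ.< ℚ.toℚᵘ p → ℤ.suc z ℤ.≤ ℚ.⌈ p ⌉
suc≤⌈⌉ z p@record{} (*<* z*↧p<↥p*1) = ℤ.i<j⇒suc[i]≤j (ℤ.*-cancelʳ-<-nonNeg {z} {ℚ.⌈ p ⌉} (↧ p)
  (ℤ.<-≤-trans (subst (z ℤ.* ↧ p ℤ.<_) (ℤ.*-identityʳ (↥ p)) z*↧p<↥p*1) (↥≤⌈⌉*↧ p)))

-- (R′/k - j)/d with k = suc k′ and d = suc d′, unnormalised.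
boundArgᵘ : ℕ → ℕ → ℕ → ℕ → ℚᵘ
boundArgᵘ R′ k′ j d′ = (mkℚᵘ (+ R′) k′ ℚᵘ.- mkℚᵘ (+ j) 0) ℚᵘ.* mkℚᵘ (+ 1) d′

-- The hypothesis is a < (R′/k - j)/d with the denominators cleared.
<boundArgᵘ : ∀ R′ k′ j d′ a → (a ℕ.* suc d′ ℕ.+ j) ℕ.* suc k′ ℕ.< R′ → mkℚᵘ (+ a) 0 ℚᵘ.< boundArgᵘ R′ k′ j d′
<boundArgᵘ R′ k′ j d′ a h = *<* (subst₂ ℤ._<_ lhs rhs (ℤ.+-monoˡ-< (ℤ.- (+ j ℤ.* + K)) (ℤ.+<+ h)))
  where
  K = suc k′
  D = suc d′
  lhs : + ((a ℕ.* D ℕ.+ j) ℕ.* K) ℤ.- + j ℤ.* + K ≡ + a ℤ.* + (K ℕ.* 1 ℕ.* D)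
  lhs = begin
    + ((a ℕ.* D ℕ.+ j) ℕ.* K) ℤ.- + j ℤ.* + K            ≡⟨ cong (ℤ._- + j ℤ.* + K) +-homo ⟩
    (+ a ℤ.* + D ℤ.+ + j) ℤ.* + K ℤ.- + j ℤ.* + K        ≡⟨ cancel (+ a) (+ D) (+ j) (+ K) ⟩
    + a ℤ.* ((+ K ℤ.* + 1) ℤ.* + D)                       ≡⟨ cong (+ a ℤ.*_) +-homo′ ⟨
    + a ℤ.* + (K ℕ.* 1 ℕ.* D)                             ∎
    where
    open ≡-Reasoning
    +-homo′ : + (K ℕ.* 1 ℕ.* D) ≡ (+ K ℤ.* + 1) ℤ.* + D
    +-homo′ = trans (ℤ.pos-* (K ℕ.* 1) D) (cong (ℤ._* + D) (ℤ.pos-* K 1))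
    +-homo : + ((a ℕ.* D ℕ.+ j) ℕ.* K) ≡ (+ a ℤ.* + D ℤ.+ + j) ℤ.* + K
    +-homo = trans (ℤ.pos-* (a ℕ.* D ℕ.+ j) K) (cong (ℤ._* + K) (trans (ℤ.pos-+ (a ℕ.* D) j) (cong (ℤ._+ + j) (ℤ.pos-* a D))))
    cancel : ∀ a d j k → (a ℤ.* d ℤ.+ j) ℤ.* k ℤ.- j ℤ.* k ≡ a ℤ.* ((k ℤ.* + 1) ℤ.* d)
    cancel = ℤ.solve-∀
  rhs : + R′ ℤ.- + j ℤ.* + K ≡ ((+ R′ ℤ.* + 1 ℤ.+ ℤ.- (+ j) ℤ.* + K) ℤ.* + 1) ℤ.* + 1
  rhs = normalise (+ R′) (+ j) (+ K)
    where
    normalise : ∀ r j k → r ℤ.- j ℤ.* k ≡ ((r ℤ.* + 1 ℤ.+ ℤ.- j ℤ.* k) ℤ.* + 1) ℤ.* + 1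
    normalise = ℤ.solve-∀

toℚᵘ-/ : ∀ i n → ℚ.toℚᵘ (i ℚ./ suc n) ℚᵘ.≃ mkℚᵘ i n
toℚᵘ-/ i n = ℚ.toℚᵘ-fromℚᵘ (mkℚᵘ i n)

toℚᵘ≃boundArgᵘ : ∀ R′ k′ j d′ →
                 ℚ.toℚᵘ (divℕ (((+ (2 ℕ.+ R′) ℤ.- + 2) ℚ./ suc k′) ℚ.- (+ j ℚ./ 1)) (suc d′)) ℚᵘ.≃ boundArgᵘ R′ k′ j d′
toℚᵘ≃boundArgᵘ R′ k′ j d′ = begin
  ℚ.toℚᵘ ((R′/k ℚ.- j/1) ℚ.* 1/d)                        ≈⟨ ℚ.toℚᵘ-homo-* (R′/k ℚ.- j/1) 1/d ⟩
  ℚ.toℚᵘ (R′/k ℚ.+ ℚ.- j/1) ℚᵘ.* ℚ.toℚᵘ 1/d              ≈⟨ ℚᵘ.*-congʳ (ℚ.toℚᵘ-homo-+ R′/k (ℚ.- j/1)) ⟩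
  (ℚ.toℚᵘ R′/k ℚᵘ.+ ℚ.toℚᵘ (ℚ.- j/1)) ℚᵘ.* ℚ.toℚᵘ 1/d   ≈⟨ ℚᵘ.*-cong (ℚᵘ.+-cong (toℚᵘ-/ (+ R′) k′) -j/1≃)
                                                                       (toℚᵘ-/ (+ 1) d′) ⟩
  boundArgᵘ R′ k′ j d′                                            ∎
  where
  open ℚᵘ.≃-Reasoning
  R′/k = + R′ ℚ./ suc k′
  j/1 = + j ℚ./ 1
  1/d = + 1 ℚ./ suc d′
  -j/1≃ : ℚ.toℚᵘ (ℚ.- j/1) ℚᵘ.≃ ℚᵘ.- mkℚᵘ (+ j) 0
  -j/1≃ = ℚᵘ.≃-trans (ℚ.toℚᵘ-homo‿- j/1) (ℚᵘ.-‿cong (toℚᵘ-/ (+ j) 0))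

-- The j-th factor of `bound k s R` for R = 2 + R′, k = suc k′ and minS k s ∸ 2 = suc d′.
boundFactor : ℕ → ℕ → ℕ → ℕ → ℤ
boundFactor R′ k′ d′ j = ℚ.⌈ divℕ (((+ (2 ℕ.+ R′) ℤ.- + 2) ℚ./ suc k′) ℚ.- (+ j ℚ./ 1)) (suc d′) ⌉

suc≤boundFactor : ∀ R′ k′ d′ j a → (a ℕ.* suc d′ ℕ.+ j) ℕ.* suc k′ ℕ.< R′ → + suc a ℤ.≤ boundFactor R′ k′ d′ j
suc≤boundFactor R′ k′ d′ j a h =
  suc≤⌈⌉ (+ a) _ (ℚᵘ.<-respʳ-≃ (ℚᵘ.≃-sym (toℚᵘ≃boundArgᵘ R′ k′ j d′)) (<boundArgᵘ R′ k′ j d′ a h))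

⌈/⌉≤boundFactor : ∀ R′ k′ d′ t′ a j → suc d′ ℕ.≤ suc t′ → suc k′ ℕ.* a ℕ.≤ R′ → j ℕ.* suc k′ ℕ.< R′ →
                    + ⌈ (a ∸ j) / suc t′ ⌉ ℤ.≤ boundFactor R′ k′ d′ j
⌈/⌉≤boundFactor R′ k′ d′ t′ a j d≤t ka≤R′ jk<R′ with ⌈ (a ∸ j) / suc t′ ⌉ in ⌈⌉≡
... | zero  = ℤ.≤-trans (ℤ.+≤+ z≤n) (suc≤boundFactor R′ k′ d′ j 0 jk<R′)
... | suc m = suc≤boundFactor R′ k′ d′ j m (begin-strict
  (m * suc d′ + j) * suc k′   <⟨ *-monoˡ-< (suc k′) md+j<a ⟩
  a * suc k′                  ≡⟨ *-comm a (suc k′) ⟩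
  suc k′ * a                  ≤⟨ ka≤R′ ⟩
  R′                          ∎)
  where
  open ≤-Reasoning
  mt<a∸j : m * suc t′ < a ∸ j
  mt<a∸j = to (<⌈/⌉⇔ t′) (subst (m <_) (sym ⌈⌉≡) (n<1+n m))
  md+j<a : m * suc d′ + j < a
  md+j<a = begin-strict
    m * suc d′ + j          ≤⟨ +-monoˡ-≤ j (*-monoʳ-≤ m d≤t) ⟩
    m * suc t′ + j          <⟨ +-monoˡ-< j mt<a∸j ⟩
    a ∸ j + j               ≡⟨ m∸n+n≡m {a} {j} (<⇒≤ (m∸n≢0⇒n<m (λ a∸j≡0 → n≮0 (subst (m * suc t′ <_) a∸j≡0 mt<a∸j)))) ⟩
    a                       ∎

*-mono-≤-nonNeg : ∀ {x X y Y} → + 0 ℤ.≤ x → + 0 ℤ.≤ y → x ℤ.≤ X → y ℤ.≤ Y → x ℤ.* y ℤ.≤ X ℤ.* Y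
*-mono-≤-nonNeg {x} {X} {y} {Y} 0≤x 0≤y x≤X y≤Y = ℤ.≤-trans
  (ℤ.*-monoʳ-≤-nonNeg y {{ℤ.nonNegative 0≤y}} x≤X)
  (ℤ.*-monoˡ-≤-nonNeg X {{ℤ.nonNegative (ℤ.≤-trans 0≤x x≤X)}} y≤Y)

1≤∏ : ∀ M (F : ℕ → ℤ) → (∀ j → j < M → + 1 ℤ.≤ F j) → + 1 ℤ.≤ foldr ℤ._*_ (+ 1) (applyUpTo F M)
1≤∏ zero    F 1≤F = ℤ.≤-refl
1≤∏ (suc M) F 1≤F = *-mono-≤-nonNeg (ℤ.+≤+ z≤n) (ℤ.+≤+ z≤n) (1≤F 0 z<s) (1≤∏ M (F ∘ suc) (λ j j<M → 1≤F (suc j) (s<s j<M)))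

⌈/⌉-tail-≤ : ∀ t n (F : ℕ → ℤ) → (∀ j → j < suc t → + ⌈ (n ∸ j) / suc t ⌉ ℤ.≤ F j) →
             ∀ j → j < t → + ⌈ (n ∸ ⌈ n / suc t ⌉ ∸ j) / t ⌉ ℤ.≤ F (suc j)
⌈/⌉-tail-≤ (suc s) n F ⌈/⌉≤F j j<t = ℤ.≤-trans (ℤ.+≤+ (⌈/⌉-tail n s j)) (⌈/⌉≤F (suc j) (s<s j<t))

turán≤∏ : ∀ t n M (F : ℕ → ℤ) → t ≤ M → (∀ j → j < t → + ⌈ (n ∸ j) / t ⌉ ℤ.≤ F j) →
          (∀ j → t ≤ j → j < M → + 1 ℤ.≤ F j) → + turán n t ℤ.≤ foldr ℤ._*_ (+ 1) (applyUpTo F M)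
turán≤∏ zero    n M       F _         _      1≤F = 1≤∏ M F (λ j → 1≤F j z≤n)
turán≤∏ (suc t) n (suc M) F (s≤s t≤M) ⌈/⌉≤F 1≤F = begin
  + (c * turán (n ∸ c) t)                    ≡⟨ ℤ.pos-* c (turán (n ∸ c) t) ⟩
  + c ℤ.* + turán (n ∸ c) t                  ≤⟨ *-mono-≤-nonNeg (ℤ.+≤+ z≤n) (ℤ.+≤+ z≤n) (⌈/⌉≤F 0 z<s)
                                                   (turán≤∏ t (n ∸ c) M (F ∘ suc) t≤M (⌈/⌉-tail-≤ t n F ⌈/⌉≤F)
                                                     (λ j t≤j j<M → 1≤F (suc j) (s≤s t≤j) (s<s j<M))) ⟩
  F 0 ℤ.* foldr ℤ._*_ (+ 1) (applyUpTo (F ∘ suc) M) ∎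
  where
  open ℤ.≤-Reasoning
  c = ⌈ n / suc t ⌉

turán≤∏boundFactor : ∀ R′ k′ d′ t L a → suc d′ ≤ t → t ≤ L → suc k′ * a ≤ R′ → (∀ j → j < L → j * suc k′ < R′) →
                       + turán a t ℤ.≤ foldr ℤ._*_ (+ 1) (applyUpTo (boundFactor R′ k′ d′) L)
turán≤∏boundFactor R′ k′ d′ (suc t′) L a d≤t t≤L ka≤R′ jk<R′ = turán≤∏ (suc t′) a L (boundFactor R′ k′ d′) t≤L
  (λ j j<t → ⌈/⌉≤boundFactor R′ k′ d′ t′ a j d≤t ka≤R′ (jk<R′ j (<-≤-trans j<t t≤L)))
  (λ j _ j<L → suc≤boundFactor R′ k′ d′ j 0 (jk<R′ j j<L))

∣nbhd-zero∣≡∣fibre∣ : ∀ {n k} (c : Coloring (suc n) k) i → ∣ nbhd c i zero ∣ ≡ ∣ setOf (λ y → c zero (suc y) ≟ i) ∣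
∣nbhd-zero∣≡∣fibre∣ c i = cong ∣_∣ (tabulate-cong λ y →
  does-⇔ (mk⇔ colour≡ (λ eq → inj₁ (z<s , eq))) (adjacent? c i zero (suc y)) (c zero (suc y) ≟ i))
  where
  colour≡ : ∀ {y} → Adjacent c i zero (suc y) → c zero (suc y) ≡ i
  colour≡ (inj₁ (_ , eq)) = eq

module Extrema {k′ : ℕ} (s : Fin (suc k′) → ℕ) where

  private
    k = suc k′
    module _ {P : ℕ → Set} where
      all-map⁺ : (∀ i → P (s i)) → All.All P (map s (allFin k))
      all-map⁺ = All.map⁺ ∘ All.tabulate⁺
      all-map⁻ : All.All P (map s (allFin k)) → ∀ i → P (s i)
      all-map⁻ Ps i = All.lookup (All.map⁻ Ps) (∈-allFin i)
    selective : ∀ {P : ℕ → Set} {_∙_ : ℕ → ℕ → ℕ} → (∀ x y → (x ∙ y ≡ x) ⊎ (x ∙ y ≡ y)) → ∀ {x y} → P x → P y → P (x ∙ y)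
    selective {P} sel {x} {y} Px Py = [ (λ eq → subst P (sym eq) Px) , (λ eq → subst P (sym eq) Py) ]′ (sel x y)

  ≤maxS : ∀ i → s i ≤ maxS k s
  ≤maxS = all-map⁻ (foldr-forcesᵇ {P = _≤ maxS k s} (λ x y ⊔≤ → m⊔n≤o⇒m≤o x y ⊔≤ , m⊔n≤o⇒n≤o x y ⊔≤) 0 _ ≤-refl)

  minS≤ : ∀ i → minS k s ≤ s i
  minS≤ = all-map⁻ (foldr-forcesᵇ {P = minS k s ≤_} (λ x y ≤⊓ → m≤n⊓o⇒m≤n x y ≤⊓ , m≤n⊓o⇒m≤o x y ≤⊓) (s zero) _ ≤-refl)

  maxS-preserves : ∀ {P : ℕ → Set} → P 0 → (∀ i → P (s i)) → P (maxS k s)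
  maxS-preserves {P} P0 Ps = foldr-preservesᵇ {P = P} {f = _⊔_} (selective {P} ⊔-sel) P0 (all-map⁺ Ps)

  minS-preserves : ∀ {P : ℕ → Set} → (∀ i → P (s i)) → P (minS k s)
  minS-preserves {P} Ps = foldr-preservesᵇ {P = P} {f = _⊓_} (selective {P} ⊓-sel) (Ps zero) (all-map⁺ Ps)

∸2≡suc∸3 : ∀ {m} → 3 ≤ m → m ∸ 2 ≡ suc (m ∸ 3)
∸2≡suc∸3 {suc (suc (suc m))} _ = refl
∸2≡suc∸3 {0}                  ()
∸2≡suc∸3 {1}                  (s≤s ())
∸2≡suc∸3 {2}                  (s≤s (s≤s ()))

<∸2⇒≤∸3 : ∀ {j} m → j < m ∸ 2 → j ≤ m ∸ 3
<∸2⇒≤∸3 (suc (suc (suc m))) j<m = s≤s⁻¹ j<m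
<∸2⇒≤∸3 0                   ()
<∸2⇒≤∸3 1                   ()
<∸2⇒≤∸3 2                   ()

module _ {k′ : ℕ} (s : Fin (suc k′) → ℕ) (s≥3 : ∀ i → 3 ≤ s i) where

  open Extrema s

  private
    k = suc k′

  multiplicity≤turán : ∀ {n M} (c : Coloring (suc n) k) → (∀ {S} → ¬ MonoClique s c S) →
                       (∀ (c′ : Coloring (suc (suc n)) k) → M ≤ countMono s c′) →
                       ∃[ i ] k * ∣ nbhd c i zero ∣ ≤ n × M ≤ turán ∣ nbhd c i zero ∣ (s i ∸ 2)
  multiplicity≤turán c good M≤count =
    let i , k∣N∣≤∑ = pigeonhole (λ i → ∣ nbhd c i zero ∣) in
    i , ≤-trans k∣N∣≤∑ (≤-reflexive ∑∣N∣≡n) ,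
    ≤-trans (M≤count (duplicate c i))
            (≤-trans (countMono-duplicate≤ s c good i)
                     (cliques≤turán c i (s i ∸ 2) (nbhd c i zero) (nbhd-cliqueFree s c good i (2≤s i))))
    where
    2≤s : ∀ i → 2 ≤ s i
    2≤s i = ≤-trans (s≤s (s≤s z≤n)) (s≥3 i)
    ∑∣N∣≡n = trans (sum-cong-≗ (∣nbhd-zero∣≡∣fibre∣ c)) (∑-∣fibre∣ (c zero ∘ suc))

  turán≤bound : ∀ {n a} i → Arrows (suc (suc n)) k s → k * a ≤ n → + turán a (s i ∸ 2) ℤ.≤ bound k s (suc (suc n))
  turán≤bound {n} {a} i arrows ka≤n = subst (+ turán a (s i ∸ 2) ℤ.≤_) (sym bound≡)
    (turán≤∏boundFactor n k′ d′ (s i ∸ 2) L a d≤t t≤L ka≤n jk<n)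
    where
    L = maxS k s ∸ 2
    d′ = minS k s ∸ 3
    minS∸2≡ : minS k s ∸ 2 ≡ suc d′
    minS∸2≡ = ∸2≡suc∸3 (minS-preserves {P = 3 ≤_} s≥3)
    bound≡ : bound k s (suc (suc n)) ≡ foldr ℤ._*_ (+ 1) (applyUpTo (boundFactor n k′ d′) L)
    bound≡ = trans (cong (foldr ℤ._*_ (+ 1)) (map-applyUpTo id _ L))
      (cong (λ D → foldr ℤ._*_ (+ 1) (applyUpTo (λ j → ℚ.⌈ divℕ (((+ suc (suc n) ℤ.- + 2) ℚ./ k) ℚ.- (+ j ℚ./ 1)) D ⌉) L))
            minS∸2≡)
    d≤t : suc d′ ≤ s i ∸ 2
    d≤t = subst (_≤ s i ∸ 2) minS∸2≡ (∸-monoˡ-≤ 2 (minS≤ i))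
    t≤L : s i ∸ 2 ≤ L
    t≤L = ∸-monoˡ-≤ 2 (≤maxS i)
    lower : k * (maxS k s ∸ 3) + 2 < suc (suc n)
    lower = maxS-preserves {P = λ x → k * (x ∸ 3) + 2 < suc (suc n)}
      (≤-<-trans (+-monoˡ-≤ 2 (*-monoʳ-≤ k z≤n)) (ramsey-lower-bound s s≥3 arrows zero))
      (ramsey-lower-bound s s≥3 arrows)
    jk<n : ∀ j → j < L → j * k < n
    jk<n j j<L = begin-strict
      j * k                  ≤⟨ *-monoˡ-≤ k (<∸2⇒≤∸3 (maxS k s) j<L) ⟩
      (maxS k s ∸ 3) * k     ≡⟨ *-comm (maxS k s ∸ 3) k ⟩
      k * (maxS k s ∸ 3)     <⟨ +-cancelʳ-< 2 _ n (subst (k * (maxS k s ∸ 3) + 2 <_) (+-comm 2 n) lower) ⟩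
      n                      ∎
      where open ≤-Reasoning

  M≤bound-of-good : ∀ {n M} → Arrows (suc (suc n)) k s → (∀ (c′ : Coloring (suc (suc n)) k) → M ≤ countMono s c′) →
                    (c : Coloring (suc n) k) → (∀ {S} → ¬ MonoClique s c S) → + M ℤ.≤ bound k s (suc (suc n))
  M≤bound-of-good arrows M≤count c good =
    let i , k∣N∣≤n , M≤turán = multiplicity≤turán c good M≤count in
    ℤ.≤-trans (ℤ.+≤+ M≤turán) (turán≤bound i arrows k∣N∣≤n)

-- Minimality of R only gives a good colouring of K_{R-1} up to double negation; this suffices
-- since the conclusion of the theorem is decidable.
¬Arrows⇒¬¬good : ∀ {n k} {s : Fin k → ℕ} → ¬ Arrows n k s → ¬ ¬ (∃[ c ] ∀ {S} → ¬ MonoClique s c S)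
¬Arrows⇒¬¬good {s = s} ¬arrows ¬good = ¬arrows λ c → byMonoClique c (anySubset? (λ S → T? (isMonoClique s c S)))
  where
  byMonoClique : ∀ c → Dec (∃[ S ] T (isMonoClique s c S)) → ∃[ S ] isMonoClique s c S ≡ true
  byMonoClique c (yes (S , mono)) = S , to T-≡ mono
  byMonoClique c (no ∄mono) = ⊥-elim (¬good (c , λ {S} mono → ∄mono (S , from (T-isMonoClique⇔ s c S) mono)))

theorem3p2 : (k : ℕ) → .{{_ : NonZero k}} → (s : Fin k → ℕ) → ((i : Fin k) → 3 ≤ s i) →
             (R M : ℕ) → IsRamsey k s R → IsCritMult k s R M → (+ M) ℤ.≤ bound k s R
theorem3p2 (suc k′) s s≥3 R M (arrows , minimal) (M≤count , _)
  with n , refl ← m≤n⇒∃[o]m+o≡n (<⇒≤ (≤-<-trans (m≤n+m 2 _) (ramsey-lower-bound s s≥3 arrows zero))) =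
  decidable-stable (+ M ℤ.≤? bound (suc k′) s (2 + n)) λ M≰bound →
    ¬Arrows⇒¬¬good (minimal (suc n) ≤-refl) λ (c , good) → M≰bound (M≤bound-of-good s s≥3 arrows M≤count c good)
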